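{- Let $n\ge 1$, $1\le m\le n$ and $0\le t\le m-1$ be integers, and let $Q=B_n(m,t)$ be the flag-shaped set of positions of an $n\times n$ matrix, of cardinality $n+t(n-m)$. Then $Q$ is a minimum blocker of all $n\times n$ $123$-avoiding permutation matrices: $Q$ is a blocker, and for every position $q\in Q$ the set $Q\setminus\{q\}$ is not a blocker.
   Context: A permutation matrix $P$ contains a $123$-pattern if the $3\times 3$ identity matrix $I_3$ is a submatrix of $P$; otherwise $P$ is $123$-avoiding. A set $Q$ of positions of an $n\times n$ matrix is a blocker if every $n\times n$ $123$-avoiding permutation matrix has a $1$ in some position of $Q$. A blocker is called minimum (in this paper's terminology) if removing any single element from it yields a set that is no longer a blocker. For integers $1\le m\le n$, $0\le t\le m-1$, $B_n(m,t)$ is the union of $\{(i,m): 1\le i\le n-t\}$ and $\{(i,j): 1\le i\le n-m+1,\ m-t\le j\le m-1\}$, positions written as (row, column). -}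

module Defs where

open import Data.Nat using (ℕ; suc; _≤_; _<_; _∸_; _+_)
open import Data.Fin using (Fin; toℕ)
open import Data.Product using (_×_; ∃; _,_)
open import Function.Bundles using (_↔_; Inverse)
open import Relation.Nullary using (¬_)
open import Relation.Binary.PropositionalEquality using (_≡_)

-- A position of an n×n matrix: (row, column), 0-indexed via Fin n.
Position : ℕ → Set
Position n = Fin n × Fin n

PosSet : ℕ → Set₁
PosSet n = Position n → Set

-- An n×n permutation matrix is given by a permutation σ of Fin n:
-- row i has its unique 1 in column σ i.
PermMatrix : ℕ → Set
PermMatrix n = Fin n ↔ Fin n

Contains123 : ∀ {n} → PermMatrix n → Set
Contains123 {n} σ = ∃ λ (i : Fin n) → ∃ λ (j : Fin n) → ∃ λ (k : Fin n) →
  (toℕ i < toℕ j) × (toℕ j < toℕ k) ×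
  (toℕ (Inverse.to σ i) < toℕ (Inverse.to σ j)) ×
  (toℕ (Inverse.to σ j) < toℕ (Inverse.to σ k))

Avoids123 : ∀ {n} → PermMatrix n → Set
Avoids123 σ = ¬ Contains123 σ

Hits : ∀ {n} → PosSet n → PermMatrix n → Set
Hits {n} Q σ = ∃ λ (i : Fin n) → Q (i , Inverse.to σ i)

IsBlocker : ∀ {n} → PosSet n → Set
IsBlocker {n} Q = (σ : PermMatrix n) → Avoids123 σ → Hits Q σ

remove : ∀ {n} → PosSet n → Position n → PosSet n
remove Q q p = Q p × ¬ (p ≡ q)

-- Minimum blocker (paper's terminology: minimal w.r.t. single removals).
IsMinimumBlocker : ∀ {n} → PosSet n → Set
IsMinimumBlocker {n} Q = IsBlocker Q × ((q : Position n) → Q q → ¬ IsBlocker (remove Q q))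

-- B_n(m,t), with 1-indexed row r = toℕ i + 1 and column c = toℕ j + 1:
--   { (r, m) : 1 ≤ r ≤ n - t }  ∪  { (r, c) : 1 ≤ r ≤ n - m + 1, m - t ≤ c ≤ m - 1 }.
data B (n m t : ℕ) : PosSet n where
  stem : ∀ {i j} → suc (toℕ j) ≡ m → suc (toℕ i) ≤ n ∸ t → B n m t (i , j)
  flag : ∀ {i j} → suc (toℕ i) ≤ suc (n ∸ m) →
         m ∸ t ≤ suc (toℕ j) → suc (toℕ j) ≤ m ∸ 1 → B n m t (i , j)

{-# OPTIONS --safe #-}
-- Rows and columns are 0-indexed; write K = m − 1 = t + e for the stem column and D = n − m.
-- Blocking: let σ avoid 123 and miss B, and let r be the row of column K; r > e + D.  If the
-- row y of some flag column e + k (k < t) lies above r, every row a ≤ D must avoid the band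
-- e … K (it would hit B) and cannot go left of it ((a, y, r) would be a 123), so D + 1 rows
-- share the D columns right of K.  Otherwise the t + 1 rows of the columns e … K all lie below
-- row e + D, where only t rows remain.
-- Minimality: for each q ∈ B we exhibit a permutation meeting B only at q in which, for some
-- threshold j, the rows with column ≤ j and the rows with column > j each form a decreasing
-- sequence; every ascent then jumps over j, so there is no 123.
module Submission where

open import Data.Empty using (⊥; ⊥-elim)
open import Data.Fin using (Fin; toℕ; fromℕ<; inject≤; punchOut)
open import Data.Fin.Properties
  using ( toℕ<n; toℕ-injective; toℕ-fromℕ<; fromℕ<-injective; toℕ-inject≤; inject≤-injective
        ; any?; injective⇒≤; punchOut-injective)
import Data.Fin.Properties as Fin
open import Data.Nat using (ℕ; zero; suc; _+_; _∸_; _≤_; _<_; z≤n; z<s; s≤s; s≤s⁻¹)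
open import Data.Nat.Properties
open import Data.Nat.Tactic.RingSolver using (solve-∀)
open import Data.Product using (_×_; _,_; proj₁; proj₂)
open import Data.Sum using (_⊎_; inj₁; inj₂)
open import Function.Base using (_∘_)
open import Function.Bundles using (_↔_; Inverse; Injection; mk↔ₛ′)
open import Function.Definitions using (Injective; StrictlySurjective)
open import Function.Properties.Inverse using (↔⇒↣)
open import Relation.Binary.Definitions using (tri<; tri≈; tri>)
open import Relation.Binary.PropositionalEquality
open import Relation.Nullary using (¬_; yes; no; contradiction)
open import Relation.Nullary.Decidable using (map′; _×-dec_; _⊎-dec_)
open import Relation.Unary using (Decidable)
open import Defs

injective⇒strictlySurjective : ∀ {n} (f : Fin n → Fin n) →
  Injective _≡_ _≡_ f → StrictlySurjective _≡_ f
injective⇒strictlySurjective {suc n} f f-inj y with any? (λ x → f x Fin.≟ y)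
... | yes hit = hit
... | no miss = contradiction (injective⇒≤ avoid-y-injective) 1+n≰n
  where
  y∉image : ∀ x → y ≢ f x
  y∉image x y≡fx = miss (x , sym y≡fx)
  avoid-y : Fin (suc n) → Fin n
  avoid-y x = punchOut (y∉image x)
  avoid-y-injective : Injective _≡_ _≡_ avoid-y
  avoid-y-injective {x} {x′} eq = f-inj (punchOut-injective (y∉image x) (y∉image x′) eq)

injective⇒↔ : ∀ {n} (f : Fin n → Fin n) → Injective _≡_ _≡_ f → Fin n ↔ Fin n
injective⇒↔ f f-inj = mk↔ₛ′ f (proj₁ ∘ preimage) (proj₂ ∘ preimage) (λ x → f-inj (proj₂ (preimage (f x))))
  where
  preimage : StrictlySurjective _≡_ f
  preimage = injective⇒strictlySurjective f f-inj

injective-above⇒≤ : ∀ {k n lo} (g : Fin k → Fin n) → Injective _≡_ _≡_ g →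
  (∀ i → lo ≤ toℕ (g i)) → k ≤ n ∸ lo
injective-above⇒≤ {lo = lo} g g-inj lo≤g = injective⇒≤ shift-injective
  where
  shift : Fin _ → Fin _
  shift i = fromℕ< (∸-monoˡ-< (toℕ<n (g i)) (lo≤g i))
  shift-injective : Injective _≡_ _≡_ shift
  shift-injective {i} {i′} eq =
    g-inj (toℕ-injective (∸-cancelʳ-≡ (lo≤g i) (lo≤g i′) (fromℕ<-injective _ _ _ _ eq)))

mirror : ℕ → ℕ → ℕ
mirror L x = L ∸ suc x

mirror-< : ∀ {L x} → x < L → mirror L x < L
mirror-< {suc L} {x} _ = s≤s (m∸n≤m L x)

mirror-≤ : ∀ L x → mirror L x ≤ L
mirror-≤ L x = m∸n≤m L (suc x)

mirror-anti : ∀ {L x y} → x < y → y < L → mirror L y < mirror L x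
mirror-anti {suc L} x<y (s≤s y≤L) = ∸-monoʳ-< x<y y≤L

mirror≡pred⇒0 : ∀ {L x} → x < L → suc (mirror L x) ≡ L → x ≡ 0
mirror≡pred⇒0 {suc L} {zero}  _          _  = refl
mirror≡pred⇒0 {suc L} {suc x} (s≤s x<L) eq =
  contradiction (suc-injective eq) (<⇒≢ (∸-monoʳ-< z<s x<L))

offset-< : ∀ {lo a L} → lo ≤ a → a < lo + L → a ∸ lo < L
offset-< {lo} {a} {L} lo≤a a<lo+L = subst (a ∸ lo <_) (m+n∸m≡n lo L) (∸-monoˡ-< a<lo+L lo≤a)

column : ∀ {n} → PermMatrix n → Fin n → ℕ
column σ i = toℕ (Inverse.to σ i)

straddling⇒avoids123 : ∀ {n} (σ : PermMatrix n) (θ : ℕ) →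
  (∀ {a b} → toℕ a < toℕ b → column σ a < column σ b → column σ a ≤ θ × θ < column σ b) →
  Avoids123 σ
straddling⇒avoids123 σ θ straddle (_ , _ , _ , a<b , b<c , σa<σb , σb<σc) =
  <⇒≱ (proj₂ (straddle a<b σa<σb)) (proj₁ (straddle b<c σb<σc))

only-hit⇒¬blocker : ∀ {n} {Q : PosSet n} {q : Position n} (σ : PermMatrix n) → Avoids123 σ →
  (∀ a → Q (a , Inverse.to σ a) → (a , Inverse.to σ a) ≡ q) → ¬ IsBlocker (remove Q q)
only-hit⇒¬blocker σ σ-avoids only-q blocks with blocks σ σ-avoids
... | a , (a∈Q , a≢q) = a≢q (only-q a a∈Q)

≡-position : ∀ {n} {a b i c : Fin n} → toℕ a ≡ toℕ i → toℕ b ≡ toℕ c → (a , b) ≡ (i , c)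
≡-position a≡i b≡c = cong₂ _,_ (toℕ-injective a≡i) (toℕ-injective b≡c)

-- Rows 0 … p−1 form the top block, containing the pivot row s.  The pivot goes to column j and
-- rows p … p+j−1 go decreasingly to columns j−1 … 0 (the low rows); the other top rows go
-- decreasingly to columns M … N−1, and rows p+j … N−1 decreasingly to columns j+v … j+1.
module Witness (s u j v : ℕ) where

  p M N : ℕ
  p = suc (s + u)
  M = suc (j + v)
  N = M + (s + u)

  N≡p+j+v : N ≡ p + j + v
  N≡p+j+v = rearrange s u j v
    where rearrange : ∀ s u j v → suc (j + v) + (s + u) ≡ suc (s + u) + j + v
          rearrange = solve-∀

  data LowRow (a : ℕ) : Set where
    pivot  : a ≡ s → LowRow a
    middle : p ≤ a → a < p + j → LowRow a

  data HighRow (a : ℕ) : Set where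
    above  : a < s → HighRow a
    below  : s < a → a < p → HighRow a
    bottom : p + j ≤ a → HighRow a

  data Row (a : ℕ) : Set where
    low  : LowRow a → Row a
    high : HighRow a → Row a

  row : ∀ a → Row a
  row a with <-cmp a s
  ... | tri< a<s _ _ = high (above a<s)
  ... | tri≈ _ a≡s _ = low (pivot a≡s)
  ... | tri> _ _ s<a with a <? p
  ...   | yes a<p = high (below s<a a<p)
  ...   | no a≮p with a <? p + j
  ...     | yes a<p+j = low (middle (≮⇒≥ a≮p) a<p+j)
  ...     | no a≮p+j = high (bottom (≮⇒≥ a≮p+j))

  lowColumn : ∀ {a} → LowRow a → ℕ
  lowColumn (pivot _) = j
  lowColumn {a} (middle _ _) = mirror j (a ∸ p)

  highColumn : ∀ {a} → HighRow a → ℕ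
  highColumn {a} (above _) = M + (mirror s a + u)
  highColumn {a} (below _ _) = M + mirror u (a ∸ suc s)
  highColumn {a} (bottom _) = suc j + mirror v (a ∸ (p + j))

  rowColumn : ∀ {a} → Row a → ℕ
  rowColumn (low r) = lowColumn r
  rowColumn (high r) = highColumn r

  f : ℕ → ℕ
  f a = rowColumn (row a)

  s<p : s < p
  s<p = s≤s (m≤m+n s u)

  p≤p+j : p ≤ p + j
  p≤p+j = m≤m+n p j

  j<M : j < M
  j<M = s≤s (m≤m+n j v)

  M≤N : M ≤ N
  M≤N = m≤m+n M (s + u)

  bottom-offset< : ∀ {a} → p + j ≤ a → a < N → a ∸ (p + j) < v
  bottom-offset< {a} p+j≤a a<N = offset-< p+j≤a (subst (a <_) N≡p+j+v a<N)

  lowColumn≤j : ∀ {a} (r : LowRow a) → lowColumn r ≤ j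
  lowColumn≤j (pivot _) = ≤-refl
  lowColumn≤j (middle _ _) = mirror-≤ j _

  j<highColumn : ∀ {a} (r : HighRow a) → j < highColumn r
  j<highColumn (above _) = <-≤-trans j<M (m≤m+n M _)
  j<highColumn (below _ _) = <-≤-trans j<M (m≤m+n M _)
  j<highColumn (bottom _) = s≤s (m≤m+n j _)

  M+u≤above : ∀ {a} (a<s : a < s) → M + u ≤ highColumn (above a<s)
  M+u≤above _ = +-monoʳ-≤ M (m≤n+m u _)

  above<N : ∀ {a} (a<s : a < s) → highColumn (above a<s) < N
  above<N a<s = +-monoʳ-< M (+-monoˡ-< u (mirror-< a<s))

  below<M+u : ∀ {a} (s<a : s < a) (a<p : a < p) → highColumn (below s<a a<p) < M + u
  below<M+u s<a a<p = +-monoʳ-< M (mirror-< (offset-< s<a a<p))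

  bottom<M : ∀ {a} (p+j≤a : p + j ≤ a) → a < N → highColumn (bottom p+j≤a) < M
  bottom<M p+j≤a a<N = s≤s (+-monoʳ-< j (mirror-< (bottom-offset< p+j≤a a<N)))

  low-decreasing : ∀ {x y} → x < y → (rx : LowRow x) (ry : LowRow y) → lowColumn ry < lowColumn rx
  low-decreasing x<y (pivot refl) (pivot refl) = contradiction x<y (<-irrefl refl)
  low-decreasing _ (pivot _) (middle p≤y y<p+j) = mirror-< (offset-< p≤y y<p+j)
  low-decreasing x<y (middle p≤x _) (pivot refl) = contradiction p≤x (<⇒≱ (<-trans x<y s<p))
  low-decreasing x<y (middle p≤x _) (middle p≤y y<p+j) =
    mirror-anti (∸-monoˡ-< x<y p≤x) (offset-< p≤y y<p+j)

  high-decreasing : ∀ {x y} → x < y → y < N → (rx : HighRow x) (ry : HighRow y) →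
    highColumn ry < highColumn rx
  high-decreasing x<y _ (above _) (above y<s) = +-monoʳ-< M (+-monoˡ-< u (mirror-anti x<y y<s))
  high-decreasing _ _ (above x<s) (below s<y y<p) = <-≤-trans (below<M+u s<y y<p) (M+u≤above x<s)
  high-decreasing _ y<N (above x<s) (bottom p+j≤y) =
    <-≤-trans (bottom<M p+j≤y y<N) (≤-trans (m≤m+n M u) (M+u≤above x<s))
  high-decreasing x<y _ (below s<x _) (above y<s) = contradiction (<-trans s<x x<y) (<-asym y<s)
  high-decreasing x<y _ (below s<x _) (below s<y y<p) =
    +-monoʳ-< M (mirror-anti (∸-monoˡ-< x<y s<x) (offset-< s<y y<p))
  high-decreasing _ y<N (below _ _) (bottom p+j≤y) = <-≤-trans (bottom<M p+j≤y y<N) (m≤m+n M _)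
  high-decreasing x<y _ (bottom p+j≤x) (above y<s) =
    contradiction p+j≤x (<⇒≱ (<-≤-trans (<-trans (<-trans x<y y<s) s<p) p≤p+j))
  high-decreasing x<y _ (bottom p+j≤x) (below _ y<p) =
    contradiction p+j≤x (<⇒≱ (<-≤-trans (<-trans x<y y<p) p≤p+j))
  high-decreasing x<y y<N (bottom p+j≤x) (bottom p+j≤y) =
    +-monoʳ-< (suc j) (mirror-anti (∸-monoˡ-< x<y p+j≤x) (bottom-offset< p+j≤y y<N))

  descent-or-straddle : ∀ {x y} → x < y → y < N → f y < f x ⊎ (f x ≤ j × j < f y)
  descent-or-straddle {x} {y} x<y y<N with row x | row y
  ... | low rx  | low ry  = inj₁ (low-decreasing x<y rx ry)
  ... | low rx  | high ry = inj₂ (lowColumn≤j rx , j<highColumn ry)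
  ... | high rx | low ry  = inj₁ (≤-<-trans (lowColumn≤j ry) (j<highColumn rx))
  ... | high rx | high ry = inj₁ (high-decreasing x<y y<N rx ry)

  f<N : ∀ {a} → a < N → f a < N
  f<N {a} a<N with row a
  ... | low r = <-≤-trans (≤-<-trans (lowColumn≤j r) j<M) M≤N
  ... | high (above a<s) = above<N a<s
  ... | high (below s<a a<p) = <-≤-trans (below<M+u s<a a<p) (+-monoʳ-≤ M (m≤n+m u s))
  ... | high (bottom p+j≤a) = <-≤-trans (bottom<M p+j≤a a<N) M≤N

  f-distinct : ∀ {x y} → x < y → y < N → f x ≢ f y
  f-distinct x<y y<N with descent-or-straddle x<y y<N
  ... | inj₁ fy<fx = >⇒≢ fy<fx
  ... | inj₂ (fx≤j , j<fy) = <⇒≢ (≤-<-trans fx≤j j<fy)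

  f-injective : ∀ {x y} → x < N → y < N → f x ≡ f y → x ≡ y
  f-injective {x} {y} x<N y<N fx≡fy with <-cmp x y
  ... | tri< x<y _ _ = contradiction fx≡fy (f-distinct x<y y<N)
  ... | tri≈ _ x≡y _ = x≡y
  ... | tri> _ _ y<x = contradiction (sym fx≡fy) (f-distinct y<x x<N)

  f-pivot : f s ≡ j
  f-pivot with row s
  ... | low (pivot _) = refl
  ... | low (middle p≤s _) = contradiction p≤s (<⇒≱ s<p)
  ... | high (above s<s) = contradiction s<s (<-irrefl refl)
  ... | high (below s<s _) = contradiction s<s (<-irrefl refl)
  ... | high (bottom p+j≤s) = contradiction p+j≤s (<⇒≱ (<-≤-trans s<p p≤p+j))

  top-block-left⇒pivot : ∀ {a} → a < p → f a < M → a ≡ s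
  top-block-left⇒pivot {a} a<p fa<M with row a
  ... | low (pivot a≡s) = a≡s
  ... | low (middle p≤a _) = contradiction p≤a (<⇒≱ a<p)
  ... | high (above a<s) = contradiction fa<M (≤⇒≯ (≤-trans (m≤m+n M u) (M+u≤above a<s)))
  ... | high (below _ _) = contradiction fa<M (≤⇒≯ (m≤m+n M _))
  ... | high (bottom p+j≤a) = contradiction p+j≤a (<⇒≱ (<-≤-trans a<p p≤p+j))

  stem-column⇒pivot-or-bottom : ∀ {a} → a < N → f a ≡ j + v → a ≡ s ⊎ a ≡ p + j
  stem-column⇒pivot-or-bottom {a} a<N fa≡j+v with row a
  ... | low (pivot a≡s) = inj₁ a≡s
  ... | low (middle p≤a a<p+j) =
    contradiction fa≡j+v (<⇒≢ (<-≤-trans (mirror-< (offset-< p≤a a<p+j)) (m≤m+n j v)))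
  ... | high (above a<s) = contradiction fa≡j+v (>⇒≢ (≤-trans (m≤m+n M u) (M+u≤above a<s)))
  ... | high (below _ _) = contradiction fa≡j+v (>⇒≢ (m≤m+n M _))
  ... | high (bottom p+j≤a) = inj₂ (begin
    a                        ≡⟨ m+[n∸m]≡n p+j≤a ⟨
    p + j + (a ∸ (p + j))    ≡⟨ cong (p + j +_) offset≡0 ⟩
    p + j + 0                ≡⟨ +-identityʳ (p + j) ⟩
    p + j                    ∎)
    where
    open ≡-Reasoning
    offset≡0 : a ∸ (p + j) ≡ 0
    offset≡0 = mirror≡pred⇒0 (bottom-offset< p+j≤a a<N)
      (+-cancelˡ-≡ j _ _ (trans (+-suc j _) fa≡j+v))

  σ : Fin N → Fin N
  σ i = fromℕ< (f<N (toℕ<n i))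

  σ-injective : Injective _≡_ _≡_ σ
  σ-injective eq = toℕ-injective (f-injective (toℕ<n _) (toℕ<n _) (fromℕ<-injective _ _ _ _ eq))

  perm : PermMatrix N
  perm = injective⇒↔ σ σ-injective

  column-perm : ∀ i → column perm i ≡ f (toℕ i)
  column-perm i = toℕ-fromℕ< (f<N (toℕ<n i))

  perm-avoids123 : Avoids123 perm
  perm-avoids123 = straddling⇒avoids123 perm j ascent-straddles
    where
    ascent-straddles : ∀ {a b} → toℕ a < toℕ b → column perm a < column perm b →
      column perm a ≤ j × j < column perm b
    ascent-straddles {a} {b} a<b ascent rewrite column-perm a | column-perm b
      with descent-or-straddle a<b (toℕ<n b)
    ... | inj₁ descent = contradiction ascent (<-asym descent)
    ... | inj₂ straddle = straddle

  stem-hit⇒f≡j+v : ∀ a → suc (column perm a) ≡ M → f (toℕ a) ≡ j + v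
  stem-hit⇒f≡j+v a on-stem = trans (sym (column-perm a)) (suc-injective on-stem)

  flag-hit⇒pivot : ∀ a → suc (toℕ a) ≤ suc (N ∸ M) → suc (column perm a) ≤ M ∸ 1 → toℕ a ≡ s
  flag-hit⇒pivot a top-row left-of-stem =
    top-block-left⇒pivot (subst (λ k → suc (toℕ a) ≤ suc k) (m+n∸m≡n M (s + u)) top-row)
      (subst (_< M) (column-perm a) (m<n⇒m<1+n left-of-stem))

  pivot-column : ∀ {a} → toℕ a ≡ s → column perm a ≡ j
  pivot-column {a} a≡s = trans (column-perm a) (trans (cong f a≡s) f-pivot)

  hits-B-only-at-pivot : ∀ {t} → v ≤ t → ∀ a → B N M t (a , Inverse.to perm a) →
    toℕ a ≡ s × column perm a ≡ j
  hits-B-only-at-pivot {t} v≤t a (stem on-stem a<N∸t)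
    with stem-column⇒pivot-or-bottom (toℕ<n a) (stem-hit⇒f≡j+v a on-stem)
  ... | inj₁ a≡s = a≡s , pivot-column a≡s
  ... | inj₂ a≡p+j = contradiction (≤-trans a<N∸t stem-ends) (<-irrefl a≡p+j)
    where
    stem-ends : N ∸ t ≤ p + j
    stem-ends = ≤-trans (∸-monoʳ-≤ N v≤t) (≤-reflexive (trans (cong (_∸ v) N≡p+j+v) (m+n∸n≡m (p + j) v)))
  hits-B-only-at-pivot _ a (flag top-row _ left-of-stem) =
    let a≡s = flag-hit⇒pivot a top-row left-of-stem in a≡s , pivot-column a≡s

  hits-B-only-at-bottom : ∀ {t} → t < v → ∀ a → B N M t (a , Inverse.to perm a) →
    toℕ a ≡ p + j × column perm a ≡ j + v
  hits-B-only-at-bottom t<v a (stem on-stem _)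
    with stem-column⇒pivot-or-bottom (toℕ<n a) (stem-hit⇒f≡j+v a on-stem)
  ... | inj₁ a≡s = contradiction (trans (sym (pivot-column a≡s)) (suc-injective on-stem))
                     (<⇒≢ (m<m+n j (≤-<-trans z≤n t<v)))
  ... | inj₂ a≡p+j = a≡p+j , suc-injective on-stem
  hits-B-only-at-bottom {t} t<v a (flag top-row right-of-band left-of-stem) =
    contradiction right-of-band (<⇒≱ (subst (λ c → suc c < M ∸ t) (sym column≡j) pivot-left-of-band))
    where
    column≡j : column perm a ≡ j
    column≡j = pivot-column (flag-hit⇒pivot a top-row left-of-stem)
    pivot-left-of-band : suc j < M ∸ t
    pivot-left-of-band = subst (suc j <_) (sym (+-∸-assoc (suc j) (<⇒≤ t<v))) (m<m+n (suc j) (m<n⇒0<n∸m t<v))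

  unblocks-at-pivot : ∀ {n m t} → N ≡ n → M ≡ m → v ≤ t → (q : Position n) →
    toℕ (proj₁ q) ≡ s → toℕ (proj₂ q) ≡ j → ¬ IsBlocker (remove (B n m t) q)
  unblocks-at-pivot {t = t} refl refl v≤t (i , c) i≡s c≡j =
    only-hit⇒¬blocker {Q = B N M t} perm perm-avoids123 λ a hit →
    let a≡s , column≡j = hits-B-only-at-pivot v≤t a hit
    in ≡-position (trans a≡s (sym i≡s)) (trans column≡j (sym c≡j))

  unblocks-at-bottom : ∀ {n m t} → N ≡ n → M ≡ m → t < v → (q : Position n) →
    toℕ (proj₁ q) ≡ p + j → toℕ (proj₂ q) ≡ j + v → ¬ IsBlocker (remove (B n m t) q)
  unblocks-at-bottom {t = t} refl refl t<v (i , c) i≡p+j c≡j+v =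
    only-hit⇒¬blocker {Q = B N M t} perm perm-avoids123 λ a hit →
    let a≡p+j , column≡j+v = hits-B-only-at-bottom t<v a hit
    in ≡-position (trans a≡p+j (sym i≡p+j)) (trans column≡j+v (sym c≡j+v))

B? : ∀ n m t → Decidable (B n m t)
B? n m t (i , c) = map′ fromSum toSum
  ((suc (toℕ c) ≟ m ×-dec suc (toℕ i) ≤? n ∸ t) ⊎-dec
   (suc (toℕ i) ≤? suc (n ∸ m) ×-dec (m ∸ t ≤? suc (toℕ c) ×-dec suc (toℕ c) ≤? m ∸ 1)))
  where
  StemCell FlagCell : Set
  StemCell = suc (toℕ c) ≡ m × suc (toℕ i) ≤ n ∸ t
  FlagCell = suc (toℕ i) ≤ suc (n ∸ m) × m ∸ t ≤ suc (toℕ c) × suc (toℕ c) ≤ m ∸ 1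
  fromSum : StemCell ⊎ FlagCell → B n m t (i , c)
  fromSum (inj₁ (on-stem , stem-row)) = stem on-stem stem-row
  fromSum (inj₂ (flag-row , from-band , to-band)) = flag flag-row from-band to-band
  toSum : B n m t (i , c) → StemCell ⊎ FlagCell
  toSum (stem on-stem stem-row) = inj₁ (on-stem , stem-row)
  toSum (flag flag-row from-band to-band) = inj₂ (flag-row , from-band , to-band)

-- Here B n m t is the stem column t + e in rows 0 … e+D together with the band columns
-- e … t+e−1 in rows 0 … D.
module Layout (t e D : ℕ) where

  m n : ℕ
  m = suc (t + e)
  n = m + D

  n∸m≡D : n ∸ m ≡ D
  n∸m≡D = m+n∸m≡n m D

  m∸t≡1+e : m ∸ t ≡ suc e
  m∸t≡1+e = trans (cong (_∸ t) (sym (+-suc t e))) (m+n∸m≡n t (suc e))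

  n≡t+[1+e+D] : n ≡ t + suc (e + D)
  n≡t+[1+e+D] = rearrange t e D
    where rearrange : ∀ t e D → suc (t + e) + D ≡ t + suc (e + D)
          rearrange = solve-∀

  n∸t≡1+e+D : n ∸ t ≡ suc (e + D)
  n∸t≡1+e+D = trans (cong (_∸ t) n≡t+[1+e+D]) (m+n∸m≡n t _)

  n∸[1+e+D]≡t : n ∸ suc (e + D) ≡ t
  n∸[1+e+D]≡t = trans (cong (_∸ suc (e + D)) n≡t+[1+e+D]) (m+n∸n≡m t (suc (e + D)))

  stem-cell : ∀ {a b : Fin n} → toℕ b ≡ t + e → toℕ a ≤ e + D → B n m t (a , b)
  stem-cell {a} b≡t+e a≤e+D = stem (cong suc b≡t+e) (subst (suc (toℕ a) ≤_) (sym n∸t≡1+e+D) (s≤s a≤e+D))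

  flag-cell : ∀ {a b : Fin n} → toℕ a ≤ D → e ≤ toℕ b → toℕ b < t + e → B n m t (a , b)
  flag-cell {a} {b} a≤D e≤b b<t+e =
    flag (subst (λ k → suc (toℕ a) ≤ suc k) (sym n∸m≡D) (s≤s a≤D))
         (subst (_≤ suc (toℕ b)) (sym m∸t≡1+e) (s≤s e≤b)) b<t+e

  data Cell (a b : ℕ) : Set where
    pivot-cell     : a ≤ D → e ≤ b → b ≤ t + e → Cell a b
    deep-stem-cell : D < a → a ≤ e + D → b ≡ t + e → Cell a b

  cell : ∀ {a b : Fin n} → B n m t (a , b) → Cell (toℕ a) (toℕ b)
  cell {a} {b} (stem on-stem stem-row) with toℕ a ≤? D
  ... | yes a≤D = pivot-cell a≤D (subst (e ≤_) (sym b≡t+e) (m≤n+m e t)) (≤-reflexive b≡t+e)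
    where
    b≡t+e : toℕ b ≡ t + e
    b≡t+e = suc-injective on-stem
  ... | no a≰D = deep-stem-cell (≰⇒> a≰D) (s≤s⁻¹ (subst (suc (toℕ a) ≤_) n∸t≡1+e+D stem-row))
                   (suc-injective on-stem)
  cell {a} {b} (flag flag-row from-band to-band) =
    pivot-cell (subst (toℕ a ≤_) n∸m≡D (s≤s⁻¹ flag-row)) (s≤s⁻¹ (subst (_≤ suc (toℕ b)) m∸t≡1+e from-band))
      (<⇒≤ to-band)

  unblock : ∀ q → B n m t q → ¬ IsBlocker (remove (B n m t) q)
  unblock (a , b) q∈B with cell q∈B
  ... | pivot-cell a≤D e≤b b≤t+e =
    Witness.unblocks-at-pivot (toℕ a) (D ∸ toℕ a) (toℕ b) (t + e ∸ toℕ b)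
      (cong₂ (λ K L → suc K + L) b+v≡t+e (m+[n∸m]≡n a≤D)) (cong suc b+v≡t+e) v≤t (a , b) refl refl
    where
    b+v≡t+e : toℕ b + (t + e ∸ toℕ b) ≡ t + e
    b+v≡t+e = m+[n∸m]≡n b≤t+e
    v≤t : t + e ∸ toℕ b ≤ t
    v≤t = ≤-trans (∸-monoʳ-≤ (t + e) e≤b) (≤-reflexive (m+n∸n≡m t e))
  -- Any top-block row can serve as pivot; its column k < e lies left of the band.
  ... | deep-stem-cell D<a a≤e+D b≡t+e =
    Witness.unblocks-at-bottom 0 D k (t + e ∸ k)
      (cong (λ K → suc K + D) k+v≡t+e) (cong suc k+v≡t+e) t<v (a , b)
      (sym (m+[n∸m]≡n D<a)) (trans b≡t+e (sym k+v≡t+e))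
    where
    k : ℕ
    k = toℕ a ∸ suc D
    k<e : k < e
    k<e = offset-< D<a (subst (toℕ a <_) (cong suc (+-comm e D)) (s≤s a≤e+D))
    k+v≡t+e : k + (t + e ∸ k) ≡ t + e
    k+v≡t+e = m+[n∸m]≡n (≤-trans (<⇒≤ k<e) (m≤n+m e t))
    t<v : t < t + e ∸ k
    t<v = subst (t <_) (sym (+-∸-assoc t (<⇒≤ k<e))) (m<m+n t (m<n⇒0<n∸m k<e))

  module _ (σ : PermMatrix n) (σ-avoids : Avoids123 σ)
           (misses : ∀ a → ¬ B n m t (a , Inverse.to σ a)) where

    to-injective : Injective _≡_ _≡_ (Inverse.to σ)
    to-injective = Injection.injective (↔⇒↣ σ)

    column-injective : ∀ {a b} → column σ a ≡ column σ b → a ≡ b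
    column-injective = to-injective ∘ toℕ-injective

    row-of : ∀ c → c < n → Fin n
    row-of c c<n = Inverse.from σ (fromℕ< c<n)

    column-row-of : ∀ {c} (c<n : c < n) → column σ (row-of c c<n) ≡ c
    column-row-of c<n = trans (cong toℕ (Inverse.strictlyInverseˡ σ _)) (toℕ-fromℕ< c<n)

    stem-row-deep : ∀ a → column σ a ≡ t + e → e + D < toℕ a
    stem-row-deep a on-stem = ≰⇒> (misses a ∘ stem-cell on-stem)

    flag-row-deep : ∀ a → e ≤ column σ a → column σ a < t + e → D < toℕ a
    flag-row-deep a e≤c c<t+e = ≰⇒> λ a≤D → misses a (flag-cell a≤D e≤c c<t+e)

    top-row-off-band : ∀ a → toℕ a ≤ D → column σ a < e ⊎ t + e < column σ a
    top-row-off-band a a≤D with column σ a <? e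
    ... | yes left = inj₁ left
    ... | no ¬left with <-cmp (column σ a) (t + e)
    ...   | tri< in-band _ _ = contradiction (flag-cell a≤D (≮⇒≥ ¬left) in-band) (misses a)
    ...   | tri≈ _ on-stem _ = contradiction (stem-cell on-stem (≤-trans a≤D (m≤n+m D e))) (misses a)
    ...   | tri> _ _ right = inj₂ right

    t+e<n : t + e < n
    t+e<n = m≤m+n m D

    r : Fin n
    r = row-of (t + e) t+e<n

    top-rows-right : ∀ {y} → e ≤ column σ y → column σ y < t + e → toℕ y < toℕ r →
      ∀ a → toℕ a ≤ D → m ≤ column σ a
    top-rows-right {y} e≤y y<t+e y<r a a≤D with top-row-off-band a a≤D
    ... | inj₂ right = right
    ... | inj₁ left = contradiction (a , y , r , a<y , y<r , <-≤-trans left e≤y , y-left-of-r) σ-avoids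
      where
      a<y : toℕ a < toℕ y
      a<y = ≤-<-trans a≤D (flag-row-deep y e≤y y<t+e)
      y-left-of-r : column σ y < column σ r
      y-left-of-r = subst (column σ y <_) (sym (column-row-of t+e<n)) y<t+e

    flag-above-stem⇒⊥ : ∀ y → e ≤ column σ y → column σ y < t + e → toℕ y < toℕ r → ⊥
    flag-above-stem⇒⊥ y e≤y y<t+e y<r =
      contradiction (subst (suc D ≤_) n∸m≡D (injective-above⇒≤ top-column top-column-injective right))
        1+n≰n
      where
      top : Fin (suc D) → Fin n
      top a = inject≤ a (s≤s (m≤n+m D (t + e)))
      top-column : Fin (suc D) → Fin n
      top-column a = Inverse.to σ (top a)
      top-column-injective : Injective _≡_ _≡_ top-column
      top-column-injective eq = inject≤-injective _ _ _ _ (to-injective eq)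
      right : ∀ a → m ≤ toℕ (top-column a)
      right a = top-rows-right e≤y y<t+e y<r (top a)
        (subst (_≤ D) (sym (toℕ-inject≤ a _)) (s≤s⁻¹ (toℕ<n a)))

    e+k<n : ∀ (k : Fin (suc t)) → e + toℕ k < n
    e+k<n k = ≤-<-trans (subst (e + toℕ k ≤_) (+-comm e t) (+-monoʳ-≤ e (s≤s⁻¹ (toℕ<n k)))) t+e<n

    band-row : Fin (suc t) → Fin n
    band-row k = row-of (e + toℕ k) (e+k<n k)

    band-row-injective : Injective _≡_ _≡_ band-row
    band-row-injective {k} {k′} eq = toℕ-injective (+-cancelˡ-≡ e _ _ (begin
      e + toℕ k              ≡⟨ column-row-of (e+k<n k) ⟨
      column σ (band-row k)  ≡⟨ cong (column σ) eq ⟩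
      column σ (band-row k′) ≡⟨ column-row-of (e+k<n k′) ⟩
      e + toℕ k′             ∎))
      where open ≡-Reasoning

    band-below-stem⇒⊥ : (∀ k → toℕ r ≤ toℕ (band-row k)) → ⊥
    band-below-stem⇒⊥ r≤band =
      contradiction (subst (suc t ≤_) n∸[1+e+D]≡t (injective-above⇒≤ band-row band-row-injective deep))
        1+n≰n
      where
      deep : ∀ k → suc (e + D) ≤ toℕ (band-row k)
      deep k = ≤-trans (stem-row-deep r (column-row-of t+e<n)) (r≤band k)

    band-above-stem⇒flag : ∀ k → toℕ (band-row k) < toℕ r → toℕ k < t
    band-above-stem⇒flag k above = ≤∧≢⇒< (s≤s⁻¹ (toℕ<n k)) λ k≡t →
      <-irrefl (cong toℕ (column-injective (begin
        column σ (band-row k) ≡⟨ column-row-of (e+k<n k) ⟩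
        e + toℕ k             ≡⟨ cong (e +_) k≡t ⟩
        e + t                 ≡⟨ +-comm e t ⟩
        t + e                 ≡⟨ column-row-of t+e<n ⟨
        column σ r            ∎))) above
      where open ≡-Reasoning

    misses⇒⊥ : ⊥
    misses⇒⊥ with any? (λ k → toℕ (band-row k) <? toℕ r)
    ... | yes (k , above) = flag-above-stem⇒⊥ (band-row k)
      (subst (e ≤_) (sym (column-row-of (e+k<n k))) (m≤m+n e _))
      (subst (_< t + e) (sym (column-row-of (e+k<n k)))
        (subst (e + toℕ k <_) (+-comm e t) (+-monoʳ-< e (band-above-stem⇒flag k above))))
      above
    ... | no none = band-below-stem⇒⊥ λ k → ≮⇒≥ (none ∘ (k ,_))

  blocks : IsBlocker (B n m t)
  blocks σ σ-avoids with any? (λ a → B? n m t (a , Inverse.to σ a))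
  ... | yes hit = hit
  ... | no miss = ⊥-elim (misses⇒⊥ σ σ-avoids λ a a∈B → miss (a , a∈B))

theorem2p3 : (n m t : ℕ) → 1 ≤ n → 1 ≤ m → m ≤ n → t ≤ m ∸ 1 →
    IsMinimumBlocker (B n m t)
theorem2p3 n (suc _) t _ (s≤s z≤n) m≤n t≤m-1 with m≤n⇒∃[o]m+o≡n t≤m-1
... | e , refl with m≤n⇒∃[o]m+o≡n m≤n
...   | D , refl = Layout.blocks t e D , Layout.unblock t e D
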